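{- Let $\mathcal{M}$ be a finite unitary magma. The Koszul dual operad $\mathrm{NC}\mathcal{M}^!$ of $\mathrm{NC}\mathcal{M}$ admits the presentation $\mathrm{NC}\mathcal{M}^!\simeq\mathrm{Free}(\mathcal{T}_\mathcal{M})/\langle\mathfrak{R}^\perp\rangle$, where $\mathfrak{R}^\perp$ is the space of relations spanned by: (a) $\sum_{\mathfrak{p}_2,\mathfrak{q}_1\in\mathcal{M},\ \mathfrak{p}_2\star\mathfrak{q}_1=\delta}\mathfrak{p}_1\mathfrak{p}_2\mathfrak{p}_3\circ_1\mathfrak{q}_1\mathfrak{q}_2\mathfrak{q}_3$ for all $\mathfrak{p}_1,\mathfrak{p}_3,\mathfrak{q}_2,\mathfrak{q}_3\in\mathcal{M}$ and $\delta\in\mathcal{M}\setminus\{\mathds{1}_\mathcal{M}\}$; (b) $\sum_{\mathfrak{p}_2,\mathfrak{q}_1\in\mathcal{M},\ \mathfrak{p}_2\star\mathfrak{q}_1=\mathds{1}_\mathcal{M}}\left(\mathfrak{p}_1\mathfrak{p}_2\mathfrak{p}_3\circ_1\mathfrak{q}_1\mathfrak{q}_2\mathfrak{q}_3-\mathfrak{p}_1\mathfrak{q}_2\mathfrak{p}_2\circ_2\mathfrak{q}_1\mathfrak{q}_3\mathfrak{p}_3\right)$ for all $\mathfrak{p}_1,\mathfrak{p}_3,\mathfrak{q}_2,\mathfrak{q}_3\in\mathcal{M}$; (c) $\sum_{\mathfrak{p}_3,\mathfrak{q}_1\in\mathcal{M},\ \mathfrak{p}_3\star\mathfrak{q}_1=\delta}\mathfrak{p}_1\mathfrak{p}_2\mathfrak{p}_3\circ_2\mathfrak{q}_1\mathfrak{q}_2\mathfrak{q}_3$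 for all $\mathfrak{p}_1,\mathfrak{p}_2,\mathfrak{q}_2,\mathfrak{q}_3\in\mathcal{M}$ and $\delta\in\mathcal{M}\setminus\{\mathds{1}_\mathcal{M}\}$.
   Context: A unitary magma is a set $\mathcal{M}$ with a binary operation $\star$ admitting a two-sided unit $\mathds{1}_\mathcal{M}$. For $n\geq 1$, an $\mathcal{M}$-clique of size $n$ is a complete graph $\mathfrak{p}$ on the vertex set $[n+1]$ with a labeling of each arc $(x,y)$, $1\le x<y\le n+1$, by $\mathfrak{p}(x,y)\in\mathcal{M}$; $(1,n+1)$ is the base, $(i,i+1)$ ($1\le i\le n$) is the $i$-th edge, and all other arcs are diagonals. An arc is solid if its label is not $\mathds{1}_\mathcal{M}$. Two diagonals $(x,y),(x',y')$ cross if $x<x'<y<y'$ or $x'<x<y'<y$. The operad $\mathrm{C}\mathcal{M}=\bigoplus_{n\ge1}\mathrm{C}\mathcal{M}(n)$ over a field of characteristic zero has $\mathrm{C}\mathcal{M}(1)$ spanned by the clique $\mathbf{u}$ of size 1 with base labeled $\mathds{1}_\mathcal{M}$ (the unit) and $\mathrm{C}\mathcal{M}(n)$, $n\ge2$, with basis all $\mathcal{M}$-cliques of size $n$. For $\mathfrak{p}$ of size $n$, $\mathfrak{q}$ of size $m$, $i\in[n]$, $\mathfrak{p}\circ_i\mathfrak{q}$ is the $\mathcal{M}$-clique of size $n+m-1$ obtained by gluing the base of $\mathfrak{q}$ onto the $i$-th edge of $\mathfrak{p}$: vertex $x$ of $\mathfrak{p}$ becomes $x$ if $x\le i$ and $x+m-1$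 if $x\ge i+1$, vertex $y$ of $\mathfrak{q}$ becomes $y+i-1$; arcs of $\mathfrak{p}$ other than its $i$-th edge and arcs of $\mathfrak{q}$ other than its base keep their labels, the arc $(i,i+m)$ gets label $\mathfrak{p}(i,i+1)\star\mathfrak{q}(1,m+1)$, and all other arcs get $\mathds{1}_\mathcal{M}$; extended bilinearly. $\mathrm{NC}\mathcal{M}$ is the suboperad of $\mathrm{C}\mathcal{M}$ spanned by $\mathbf{u}$ and all $\mathcal{M}$-cliques having no two crossing solid diagonals; it is a binary quadratic operad generated by the set $\mathcal{T}_\mathcal{M}$ of $\mathcal{M}$-triangles ($\mathcal{M}$-cliques of size 2). The triangle $\mathfrak{p}$ with $\mathfrak{p}(1,3)=\mathfrak{p}_1$, $\mathfrak{p}(1,2)=\mathfrak{p}_2$, $\mathfrak{p}(2,3)=\mathfrak{p}_3$ is written as the word $\mathfrak{p}_1\mathfrak{p}_2\mathfrak{p}_3\in\mathcal{M}^3$. $\mathrm{Free}(\mathcal{T}_\mathcal{M})$ is the free operad on $\mathcal{T}_\mathcal{M}$ in arity 2, and $\mathrm{NC}\mathcal{M}^!$ denotes the Koszul dual of the quadratic operad $\mathrm{NC}\mathcal{M}$. -}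

module Defs where

open import Level using (Level; _⊔_; suc)
open import Data.Nat using (ℕ; zero) renaming (suc to sucℕ)
open import Data.Bool using (Bool; true; false; _∧_; if_then_else_)
open import Data.Product using (_×_; _,_; ∃; ∃-syntax)
open import Data.List using (List; []; _∷_; map; concatMap)
open import Data.List.Membership.Propositional using (_∈_)
open import Data.List.Relation.Unary.Unique.Propositional using (Unique)
open import Relation.Binary.PropositionalEquality using (_≡_; _≢_)
open import Relation.Binary.Definitions using (DecidableEquality)
open import Relation.Nullary.Decidable using (⌊_⌋)
open import Relation.Nullary using (¬_)
open import Algebra.Bundles using (CommutativeRing)

record Field (c ℓ : Level) : Set (Level.suc (c ⊔ ℓ)) where
  field
    commRing : CommutativeRing c ℓ
  open CommutativeRing commRing public
  field
    nontrivial : ¬ (1# ≈ 0#)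
    inverse    : ∀ x → ¬ (x ≈ 0#) → ∃[ y ] (x * y ≈ 1#)

module _ {c ℓ} (K : Field c ℓ) where
  open Field K

  ℕ→K : ℕ → Carrier
  ℕ→K zero = 0#
  ℕ→K (sucℕ n) = 1# + ℕ→K n

  CharacteristicZero : Set ℓ
  CharacteristicZero = ∀ n → ¬ (ℕ→K (sucℕ n) ≈ 0#)

record FiniteUnitaryMagma (m : Level) : Set (Level.suc m) where
  field
    Carrier   : Set m
    _⋆_       : Carrier → Carrier → Carrier
    𝟙         : Carrier
    identityˡ : ∀ x → 𝟙 ⋆ x ≡ x
    identityʳ : ∀ x → x ⋆ 𝟙 ≡ x
    _≟_       : DecidableEquality Carrier
    -- finiteness: an exhaustive duplicate-free enumeration
    elems     : List Carrier
    complete  : ∀ x → x ∈ elems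
    unique    : Unique elems

module Koszul {c ℓ m} (K : Field c ℓ) (M : FiniteUnitaryMagma m) where
  open Field K renaming (Carrier to 𝕂)
  open FiniteUnitaryMagma M renaming (Carrier to 𝓜)

  -- M-triangle p1 p2 p3 : p(1,3)=p1, p(1,2)=p2, p(2,3)=p3
  Triangle : Set m
  Triangle = 𝓜 × 𝓜 × 𝓜

  data Pos : Set where
    ∘₁ ∘₂ : Pos

  -- basis of Free(T_M)(3): the formal compositions t ∘ᵢ s
  Basis3 : Set m
  Basis3 = Pos × Triangle × Triangle

  triangles : List Triangle
  triangles = concatMap (λ a → concatMap (λ b → map (λ c → a , b , c) elems) elems) elems

  basis3 : List Basis3
  basis3 = concatMap (λ i → concatMap (λ t → map (λ s → i , t , s) triangles) triangles) (∘₁ ∷ ∘₂ ∷ [])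

  sumK : ∀ {a} {A : Set a} → List A → (A → 𝕂) → 𝕂
  sumK [] f = 0#
  sumK (x ∷ xs) f = f x + sumK xs f

  -- elements of Free(T_M)(3) as coefficient functions on the basis
  Free3 : Set (c ⊔ m)
  Free3 = Basis3 → 𝕂

  -- M-cliques of size 3: labels of arcs (1,2),(2,3),(3,4),(1,3),(2,4),(1,4)
  Clique3 : Set m
  Clique3 = 𝓜 × 𝓜 × 𝓜 × 𝓜 × 𝓜 × 𝓜

  -- evaluation of a formal composition in CM (operad composition ∘ᵢ)
  eval : Basis3 → Clique3
  eval (∘₁ , (p1 , p2 , p3) , (q1 , q2 , q3)) = q2 , q3 , p3 , p2 ⋆ q1 , 𝟙 , p1
  eval (∘₂ , (p1 , p2 , p3) , (q1 , q2 , q3)) = p2 , q2 , q3 , 𝟙 , p3 ⋆ q1 , p1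

  _==_ : 𝓜 → 𝓜 → Bool
  x == y = ⌊ x ≟ y ⌋

  _==c_ : Clique3 → Clique3 → Bool
  (a1 , a2 , a3 , a4 , a5 , a6) ==c (b1 , b2 , b3 , b4 , b5 , b6) =
    (a1 == b1) ∧ (a2 == b2) ∧ (a3 == b3) ∧ (a4 == b4) ∧ (a5 == b5) ∧ (a6 == b6)

  ind : Bool → 𝕂
  ind b = if b then 1# else 0#

  -- the linear map Free(T_M)(3) → CM(3) induced by the composition, at clique κ
  evalLin : Free3 → Clique3 → 𝕂
  evalLin x κ = sumK basis3 (λ b → x b * ind (eval b ==c κ))

  -- R : the space of quadratic relations of NCM (kernel of evaluation in arity 3)
  InR : Free3 → Set (ℓ ⊔ m)
  InR x = ∀ κ → evalLin x κ ≈ 0#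

  -- the pairing used to define the Koszul dual of a nonsymmetric binary
  -- quadratic operad: ⟨t∘₁s, t'∘₁s'⟩ = δ, ⟨t∘₂s, t'∘₂s'⟩ = -δ
  sign : Pos → 𝕂
  sign ∘₁ = 1#
  sign ∘₂ = - 1#

  pairing : Free3 → Free3 → 𝕂
  pairing x y = sumK basis3 (λ b → sign (Data.Product.proj₁ b) * (x b * y b))

  InR⊥ : Free3 → Set (c ⊔ ℓ ⊔ m)
  InR⊥ x = ∀ y → InR y → pairing x y ≈ 0#

  -- index set of the claimed spanning family of R^⊥
  data Gen : Set m where
    genA : (p1 p3 q2 q3 δ : 𝓜) → δ ≢ 𝟙 → Gen
    genB : (p1 p3 q2 q3 : 𝓜) → Gen
    genC : (p1 p2 q2 q3 δ : 𝓜) → δ ≢ 𝟙 → Gen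

  gen : Gen → Free3
  -- (a) Σ_{p2 ⋆ q1 = δ} p1p2p3 ∘₁ q1q2q3
  gen (genA p1 p3 q2 q3 δ _) (∘₁ , (a1 , a2 , a3) , (b1 , b2 , b3)) =
    ind ((a1 == p1) ∧ (a3 == p3) ∧ (b2 == q2) ∧ (b3 == q3) ∧ ((a2 ⋆ b1) == δ))
  gen (genA _ _ _ _ _ _) (∘₂ , _ , _) = 0#
  -- (b) Σ_{p2 ⋆ q1 = 𝟙} (p1p2p3 ∘₁ q1q2q3 − p1q2p2 ∘₂ q1q3p3)
  gen (genB p1 p3 q2 q3) (∘₁ , (a1 , a2 , a3) , (b1 , b2 , b3)) =
    ind ((a1 == p1) ∧ (a3 == p3) ∧ (b2 == q2) ∧ (b3 == q3) ∧ ((a2 ⋆ b1) == 𝟙))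
  gen (genB p1 p3 q2 q3) (∘₂ , (a1 , a2 , a3) , (b1 , b2 , b3)) =
    - ind ((a1 == p1) ∧ (a2 == q2) ∧ (b2 == q3) ∧ (b3 == p3) ∧ ((a3 ⋆ b1) == 𝟙))
  -- (c) Σ_{p3 ⋆ q1 = δ} p1p2p3 ∘₂ q1q2q3
  gen (genC _ _ _ _ _ _) (∘₁ , _ , _) = 0#
  gen (genC p1 p2 q2 q3 δ _) (∘₂ , (a1 , a2 , a3) , (b1 , b2 , b3)) =
    ind ((a1 == p1) ∧ (a2 == p2) ∧ (b2 == q2) ∧ (b3 == q3) ∧ ((a3 ⋆ b1) == δ))

  InSpanGen : Free3 → Set (c ⊔ ℓ ⊔ m)
  InSpanGen x = ∃[ cs ] (∀ b → x b ≈ sumK {A = 𝕂 × Gen} cs (λ { (k , g) → k * gen g b }))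

-- With sign the Koszul sign (+1 on ∘₁, -1 on ∘₂) and eval the composition
-- map from formal compositions t ∘ᵢ s to M-cliques of size 3, both sides
-- are identified with the x for which sign · x is constant on the fibres
-- of eval.  (1) e_b - e_b' lies in R when eval b = eval b', so elements of
-- R^⊥ are fibrewise constant.  (2) Each generator is a signed indicator of
-- one fibre; pairing it with y gives a multiple of the coordinate of
-- eval y there, so the span of the generators lies in R^⊥.  (3) Every fibre
-- is the fibre of exactly one generator g, with a canonical element repr g,
-- and a fibrewise constant x equals Σ_g x (repr g) · g.
module Submission where

open import Defs
open import Level using (_⊔_)
open import Function.Bundles using (_⇔_; mk⇔)
open import Data.Bool using (true; false; _∧_)
open import Data.Bool.Properties using (∧-idempotentCommutativeMonoid)
open import Data.Product using (_×_; _,_; proj₁; proj₂)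
open import Data.Product.Properties using (≡-dec)
open import Data.List using (List; []; _∷_; _++_; map; concatMap)
open import Data.List.Membership.Propositional using (_∈_)
open import Data.List.Relation.Unary.Any using (here; there)
open import Data.List.Relation.Unary.All using ([]; _∷_)
import Data.List.Relation.Unary.All as All
open import Data.List.Relation.Unary.AllPairs using ([]; _∷_)
open import Data.List.Relation.Unary.Unique.Propositional using (Unique)
open import Data.Empty using (⊥-elim)
open import Relation.Nullary using (yes; no)
open import Relation.Binary.Definitions using (DecidableEquality)
open import Relation.Binary.PropositionalEquality as P using (_≡_; _≢_)
import Algebra.Solver.IdempotentCommutativeMonoid as ICM-Solver

-- The two rearrangements of Boolean conjunctions that relate the support
-- of a generator to the fibre of its clique (routine, by the ∧-solver).
module BooleanReordering where
  open ICM-Solver ∧-idempotentCommutativeMonoid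

  ∘₁-reorder : ∀ A B C D E → (A ∧ B ∧ C ∧ D ∧ E) ≡ (C ∧ D ∧ B ∧ E ∧ true ∧ A)
  ∘₁-reorder = solve 5 (λ A B C D E →
    A ⊕ (B ⊕ (C ⊕ (D ⊕ E))) ⊜ C ⊕ (D ⊕ (B ⊕ (E ⊕ (id ⊕ A))))) P.refl

  ∘₂-reorder : ∀ A B C D E → (A ∧ B ∧ C ∧ D ∧ E) ≡ (B ∧ C ∧ D ∧ true ∧ E ∧ A)
  ∘₂-reorder = solve 5 (λ A B C D E →
    A ⊕ (B ⊕ (C ⊕ (D ⊕ E))) ⊜ B ⊕ (C ⊕ (D ⊕ (id ⊕ (E ⊕ A))))) P.refl

open BooleanReordering

module KoszulDualOfNCM {c ℓ m} (K : Field c ℓ) (M : FiniteUnitaryMagma m) where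
  open Koszul K M
  open Field K renaming (Carrier to 𝕂)
  open FiniteUnitaryMagma M renaming (Carrier to 𝓜)
  open import Relation.Binary.Reasoning.Setoid setoid
  open import Algebra.Properties.Ring ring using (-1*x≈-x; -‿distribʳ-*)
  open import Algebra.Properties.AbelianGroup +-abelianGroup
    using (⁻¹-involutive; ε⁻¹≈ε; ⁻¹-∙-comm; x∙y⁻¹≈ε⇒x≈y; x≈y⇒x∙y⁻¹≈ε)

  module _ {a} {A : Set a} where

    sumK-cong : ∀ (L : List A) {f g : A → 𝕂} → (∀ z → f z ≈ g z) → sumK L f ≈ sumK L g
    sumK-cong []      e = refl
    sumK-cong (z ∷ L) e = +-cong (e z) (sumK-cong L e)

    sumK-zero : ∀ (L : List A) {f : A → 𝕂} → (∀ {z} → z ∈ L → f z ≈ 0#) → sumK L f ≈ 0#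
    sumK-zero []      e = refl
    sumK-zero (z ∷ L) e = trans (+-cong (e (here P.refl)) (sumK-zero L (λ w∈L → e (there w∈L)))) (+-identityˡ 0#)

    sumK-++ : ∀ (xs ys : List A) (f : A → 𝕂) → sumK (xs ++ ys) f ≈ sumK xs f + sumK ys f
    sumK-++ []       ys f = sym (+-identityˡ _)
    sumK-++ (x ∷ xs) ys f = trans (+-cong refl (sumK-++ xs ys f)) (sym (+-assoc _ _ _))

    sumK-+ : ∀ (L : List A) (f g : A → 𝕂) → sumK L (λ z → f z + g z) ≈ sumK L f + sumK L g
    sumK-+ []      f g = sym (+-identityˡ 0#)
    sumK-+ (z ∷ L) f g = begin
      (f z + g z) + sumK L (λ w → f w + g w) ≈⟨ +-cong refl (sumK-+ L f g) ⟩
      (f z + g z) + (sumK L f + sumK L g)   ≈⟨ +-assoc _ _ _ ⟩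
      f z + (g z + (sumK L f + sumK L g))   ≈⟨ +-cong refl (+-comm _ _) ⟩
      f z + ((sumK L f + sumK L g) + g z)   ≈⟨ +-cong refl (+-assoc _ _ _) ⟩
      f z + (sumK L f + (sumK L g + g z))   ≈⟨ sym (+-assoc _ _ _) ⟩
      (f z + sumK L f) + (sumK L g + g z)   ≈⟨ +-cong refl (+-comm _ _) ⟩
      (f z + sumK L f) + (g z + sumK L g)   ∎

    sumK-neg : ∀ (L : List A) (f : A → 𝕂) → sumK L (λ z → - f z) ≈ - sumK L f
    sumK-neg []      f = sym ε⁻¹≈ε
    sumK-neg (z ∷ L) f = trans (+-cong refl (sumK-neg L f)) (⁻¹-∙-comm _ _)

    sumK-*ˡ : ∀ k (L : List A) (f : A → 𝕂) → k * sumK L f ≈ sumK L (λ z → k * f z)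
    sumK-*ˡ k []      f = zeroʳ k
    sumK-*ˡ k (z ∷ L) f = trans (distribˡ k _ _) (+-cong refl (sumK-*ˡ k L f))

    sumK-*ʳ : ∀ k (L : List A) (f : A → 𝕂) → sumK L f * k ≈ sumK L (λ z → f z * k)
    sumK-*ʳ k L f = trans (*-comm _ k) (trans (sumK-*ˡ k L f) (sumK-cong L (λ z → *-comm k (f z))))

    sumK-map : ∀ {b} {B : Set b} (g : B → A) (xs : List B) (f : A → 𝕂) →
               sumK (map g xs) f ≈ sumK xs (λ z → f (g z))
    sumK-map g []       f = refl
    sumK-map g (x ∷ xs) f = +-cong refl (sumK-map g xs f)

    sumK-concatMap : ∀ {b} {B : Set b} (g : B → List A) (xs : List B) (f : A → 𝕂) →
                     sumK (concatMap g xs) f ≈ sumK xs (λ z → sumK (g z) f)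
    sumK-concatMap g []       f = refl
    sumK-concatMap g (x ∷ xs) f = trans (sumK-++ (g x) _ f) (+-cong refl (sumK-concatMap g xs f))

  sumK-swap : ∀ {a b} {A : Set a} {B : Set b} (xs : List A) (ys : List B) (F : A → B → 𝕂) →
    sumK xs (λ x → sumK ys (F x)) ≈ sumK ys (λ y → sumK xs (λ x → F x y))
  sumK-swap []       ys F = sym (sumK-zero ys (λ _ → refl))
  sumK-swap (x ∷ xs) ys F = trans (+-cong refl (sumK-swap xs ys F)) (sym (sumK-+ ys (F x) _))

  Cube : ∀ {a b d} {A : Set a} {B : Set b} {C : Set d} → List A → List B → List C → List (A × B × C)
  Cube xs ys zs = concatMap (λ x → concatMap (λ y → map (λ z → x , y , z) zs) ys) xs

  sumK-Cube : ∀ {a b d} {A : Set a} {B : Set b} {C : Set d} (xs : List A) (ys : List B) (zs : List C) (h : A × B × C → 𝕂) →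
    sumK (Cube xs ys zs) h ≈ sumK xs (λ x → sumK ys (λ y → sumK zs (λ z → h (x , y , z))))
  sumK-Cube xs ys zs h =
    trans (sumK-concatMap _ xs h) (sumK-cong xs (λ x →
    trans (sumK-concatMap _ ys h) (sumK-cong ys (λ y → sumK-map (λ z → x , y , z) zs h))))

  IsDelta : ∀ {a} {A : Set a} → ((A → 𝕂) → 𝕂) → Set (a ⊔ c ⊔ ℓ)
  IsDelta {A = A} S = ∀ (h : A → 𝕂) a → (∀ z → z ≢ a → h z ≈ 0#) → S h ≈ h a

  delta-unique : ∀ {a} {A : Set a} {xs : List A} → Unique xs → (∀ x → x ∈ xs) → IsDelta (sumK xs)
  delta-unique {xs = xs} u complete h a vanish = delta-member xs u (complete a)
    where
    delta-member : ∀ ys → Unique ys → a ∈ ys → sumK ys h ≈ h a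
    delta-member (y ∷ ys) (y∉ys ∷ _) (here P.refl) =
      trans (+-cong refl (sumK-zero ys (λ w∈ys → vanish _ (λ w≡y → All.lookup y∉ys w∈ys (P.sym w≡y)))))
            (+-identityʳ _)
    delta-member (y ∷ ys) (y∉ys ∷ u) (there a∈ys) =
      trans (+-cong (vanish y (All.lookup y∉ys a∈ys)) (delta-member ys u a∈ys)) (+-identityˡ _)

  delta-× : ∀ {a b} {A : Set a} {B : Set b} {S : (A → 𝕂) → 𝕂} {T : (B → 𝕂) → 𝕂} → IsDelta S → IsDelta T →
            IsDelta (λ h → S (λ x → T (λ y → h (x , y))))
  delta-× dS dT h (a , b) vanish =
    trans (dS _ a (λ x x≢a → trans (dT _ b (λ y _ → vanish _ (λ e → x≢a (P.cong proj₁ e))))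
                                   (vanish _ (λ e → x≢a (P.cong proj₁ e)))))
          (dT _ b (λ y y≢b → vanish _ (λ e → y≢b (P.cong proj₂ e))))

  -- triangles and basis3 are (definitionally) cubes of delta enumerations
  delta-Cube : ∀ {a b d} {A : Set a} {B : Set b} {C : Set d} (xs : List A) (ys : List B) (zs : List C) →
    IsDelta (sumK xs) → IsDelta (sumK ys) → IsDelta (sumK zs) → IsDelta (sumK (Cube xs ys zs))
  delta-Cube xs ys zs dx dy dz h a vanish =
    trans (sumK-Cube xs ys zs h) (delta-× dx (delta-× dy dz) h a vanish)

  delta-elems : IsDelta (sumK elems)
  delta-elems = delta-unique unique complete

  delta-positions : IsDelta (sumK (∘₁ ∷ ∘₂ ∷ []))
  delta-positions = delta-unique (((λ ()) ∷ []) ∷ [] ∷ []) position-listed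
    where
    position-listed : ∀ i → i ∈ ∘₁ ∷ ∘₂ ∷ []
    position-listed ∘₁ = here P.refl
    position-listed ∘₂ = there (here P.refl)

  delta-basis3 : IsDelta (sumK basis3)
  delta-basis3 = delta-Cube (∘₁ ∷ ∘₂ ∷ []) triangles triangles delta-positions triangles-delta triangles-delta
    where
    triangles-delta : IsDelta (sumK triangles)
    triangles-delta = delta-Cube elems elems elems delta-elems delta-elems delta-elems

  _≟P_ : DecidableEquality Pos
  ∘₁ ≟P ∘₁ = yes P.refl
  ∘₂ ≟P ∘₂ = yes P.refl
  ∘₁ ≟P ∘₂ = no (λ ())
  ∘₂ ≟P ∘₁ = no (λ ())

  _≟B_ : DecidableEquality Basis3
  _≟B_ = ≡-dec _≟P_ (≡-dec triangle-dec triangle-dec)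
    where
    triangle-dec : DecidableEquality Triangle
    triangle-dec = ≡-dec _≟_ (≡-dec _≟_ _≟_)

  point : Basis3 → Free3
  point b z with z ≟B b
  ... | yes _ = 1#
  ... | no _  = 0#

  sum-point : ∀ (F : Basis3 → 𝕂) b → sumK basis3 (λ z → F z * point b z) ≈ F b
  sum-point F b = trans (delta-basis3 _ b off) at
    where
    off : ∀ z → z ≢ b → F z * point b z ≈ 0#
    off z z≢b with z ≟B b
    ... | yes z≡b = ⊥-elim (z≢b z≡b)
    ... | no _    = zeroʳ (F z)
    at : F b * point b b ≈ F b
    at with b ≟B b
    ... | yes _   = *-identityʳ (F b)
    ... | no b≢b  = ⊥-elim (b≢b P.refl)

  sum-point-difference : ∀ (F : Basis3 → 𝕂) b b' →
    sumK basis3 (λ z → F z * (point b z + - point b' z)) ≈ F b + - F b'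
  sum-point-difference F b b' = begin
    sumK basis3 (λ z → F z * (point b z + - point b' z))
      ≈⟨ sumK-cong basis3 (λ z → trans (distribˡ _ _ _) (+-cong refl (sym (-‿distribʳ-* _ _)))) ⟩
    sumK basis3 (λ z → F z * point b z + - (F z * point b' z))
      ≈⟨ sumK-+ basis3 _ _ ⟩
    sumK basis3 (λ z → F z * point b z) + sumK basis3 (λ z → - (F z * point b' z))
      ≈⟨ +-cong (sum-point F b) (trans (sumK-neg basis3 _) (-‿cong (sum-point F b'))) ⟩
    F b + - F b' ∎

  ==-refl : ∀ a → (a == a) ≡ true
  ==-refl a with a ≟ a
  ... | yes _   = P.refl
  ... | no a≢a  = ⊥-elim (a≢a P.refl)

  ==c-refl : ∀ κ → (κ ==c κ) ≡ true
  ==c-refl (a1 , a2 , a3 , a4 , a5 , a6)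
    rewrite ==-refl a1 | ==-refl a2 | ==-refl a3 | ==-refl a4 | ==-refl a5 | ==-refl a6 = P.refl

  ==c-sound : ∀ κ κ' → (κ ==c κ') ≡ true → κ ≡ κ'
  ==c-sound (a1 , a2 , a3 , a4 , a5 , a6) (b1 , b2 , b3 , b4 , b5 , b6) t
    with a1 ≟ b1 | a2 ≟ b2 | a3 ≟ b3 | a4 ≟ b4 | a5 ≟ b5 | a6 ≟ b6 | t
  ... | yes P.refl | yes P.refl | yes P.refl | yes P.refl | yes P.refl | yes P.refl | _ = P.refl
  ... | no _  | _     | _     | _     | _     | _    | ()
  ... | yes _ | no _  | _     | _     | _     | _    | ()
  ... | yes _ | yes _ | no _  | _     | _     | _    | ()
  ... | yes _ | yes _ | yes _ | no _  | _     | _    | ()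
  ... | yes _ | yes _ | yes _ | yes _ | no _  | _    | ()
  ... | yes _ | yes _ | yes _ | yes _ | yes _ | no _ | ()

  indicator-on : ∀ {κ κ'} → κ ≡ κ' → ind (κ ==c κ') ≈ 1#
  indicator-on {κ} P.refl = reflexive (P.cong ind (==c-refl κ))

  indicator-off : ∀ {κ κ'} → κ ≢ κ' → ind (κ ==c κ') ≈ 0#
  indicator-off {κ} {κ'} κ≢κ' with κ ==c κ' in t
  ... | true  = ⊥-elim (κ≢κ' (==c-sound κ κ' t))
  ... | false = refl

  sign-involutive : ∀ i u → sign i * (sign i * u) ≈ u
  sign-involutive ∘₁ u = trans (*-identityˡ _) (*-identityˡ u)
  sign-involutive ∘₂ u = trans (-1*x≈-x _) (trans (-‿cong (-1*x≈-x u)) (⁻¹-involutive u))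

  sign-transpose : ∀ i {u v} → sign i * u ≈ v → u ≈ sign i * v
  sign-transpose i {u} e = trans (sym (sign-involutive i u)) (*-cong refl e)

  FibreConstant : Free3 → Set (ℓ ⊔ m)
  FibreConstant x = ∀ b b' → eval b ≡ eval b' → sign (proj₁ b) * x b ≈ sign (proj₁ b') * x b'

  point-difference-in-R : ∀ b b' → eval b ≡ eval b' → InR (λ z → point b z + - point b' z)
  point-difference-in-R b b' same κ = begin
    sumK basis3 (λ z → (point b z + - point b' z) * ind (eval z ==c κ))
      ≈⟨ sumK-cong basis3 (λ z → *-comm _ _) ⟩
    sumK basis3 (λ z → ind (eval z ==c κ) * (point b z + - point b' z))
      ≈⟨ sum-point-difference (λ z → ind (eval z ==c κ)) b b' ⟩
    ind (eval b ==c κ) + - ind (eval b' ==c κ)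
      ≈⟨ x≈y⇒x∙y⁻¹≈ε (reflexive (P.cong (λ κ'' → ind (κ'' ==c κ)) same)) ⟩
    0# ∎

  orthogonal-fibre-constant : ∀ x → InR⊥ x → FibreConstant x
  orthogonal-fibre-constant x x⊥R b b' same = x∙y⁻¹≈ε⇒x≈y _ _ (begin
    sign (proj₁ b) * x b + - (sign (proj₁ b') * x b')
      ≈⟨ sum-point-difference (λ z → sign (proj₁ z) * x z) b b' ⟨
    sumK basis3 (λ z → (sign (proj₁ z) * x z) * (point b z + - point b' z))
      ≈⟨ sumK-cong basis3 (λ z → *-assoc _ _ _) ⟩
    pairing x (λ z → point b z + - point b' z)
      ≈⟨ x⊥R _ (point-difference-in-R b b' same) ⟩
    0# ∎)

  SignedIndicator : 𝕂 → Clique3 → Free3 → Set (ℓ ⊔ m)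
  SignedIndicator k κ v = ∀ b → sign (proj₁ b) * v b ≈ k * ind (eval b ==c κ)

  pairing-signed-indicator : ∀ {k κ v} → SignedIndicator k κ v → ∀ y → pairing v y ≈ k * evalLin y κ
  pairing-signed-indicator {k} {κ} {v} hv y = begin
    sumK basis3 (λ b → sign (proj₁ b) * (v b * y b)) ≈⟨ sumK-cong basis3 term ⟩
    sumK basis3 (λ b → k * (y b * ind (eval b ==c κ))) ≈⟨ sumK-*ˡ k basis3 _ ⟨
    k * evalLin y κ ∎
    where
    term : ∀ b → sign (proj₁ b) * (v b * y b) ≈ k * (y b * ind (eval b ==c κ))
    term b = begin
      sign (proj₁ b) * (v b * y b)     ≈⟨ *-assoc _ _ _ ⟨
      (sign (proj₁ b) * v b) * y b     ≈⟨ *-cong (hv b) refl ⟩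
      (k * ind (eval b ==c κ)) * y b   ≈⟨ *-assoc _ _ _ ⟩
      k * (ind (eval b ==c κ) * y b)   ≈⟨ *-cong refl (*-comm _ _) ⟩
      k * (y b * ind (eval b ==c κ))   ∎

  pairing-linear : ∀ {i} {I : Set i} (cs : List (𝕂 × I)) (v : I → Free3) x →
    (∀ b → x b ≈ sumK cs (λ kv → proj₁ kv * v (proj₂ kv) b)) →
    ∀ y → pairing x y ≈ sumK cs (λ kv → proj₁ kv * pairing (v (proj₂ kv)) y)
  pairing-linear cs v x hx y = begin
    sumK basis3 (λ b → sign (proj₁ b) * (x b * y b))
      ≈⟨ sumK-cong basis3 expand ⟩
    sumK basis3 (λ b → sumK cs (λ kv → proj₁ kv * (sign (proj₁ b) * (v (proj₂ kv) b * y b))))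
      ≈⟨ sumK-swap basis3 cs _ ⟩
    sumK cs (λ kv → sumK basis3 (λ b → proj₁ kv * (sign (proj₁ b) * (v (proj₂ kv) b * y b))))
      ≈⟨ sumK-cong cs (λ kv → sumK-*ˡ (proj₁ kv) basis3 _) ⟨
    sumK cs (λ kv → proj₁ kv * pairing (v (proj₂ kv)) y) ∎
    where
    rearrange : ∀ s k w u → s * ((k * w) * u) ≈ k * (s * (w * u))
    rearrange s k w u = begin
      s * ((k * w) * u) ≈⟨ *-cong refl (*-assoc k w u) ⟩
      s * (k * (w * u)) ≈⟨ *-assoc s k _ ⟨
      (s * k) * (w * u) ≈⟨ *-cong (*-comm s k) refl ⟩
      (k * s) * (w * u) ≈⟨ *-assoc k s _ ⟩
      k * (s * (w * u)) ∎
    expand : ∀ b → sign (proj₁ b) * (x b * y b) ≈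
             sumK cs (λ kv → proj₁ kv * (sign (proj₁ b) * (v (proj₂ kv) b * y b)))
    expand b = begin
      sign (proj₁ b) * (x b * y b)
        ≈⟨ *-cong refl (trans (*-cong (hx b) refl) (sumK-*ʳ (y b) cs _)) ⟩
      sign (proj₁ b) * sumK cs (λ kv → (proj₁ kv * v (proj₂ kv) b) * y b)
        ≈⟨ sumK-*ˡ _ cs _ ⟩
      sumK cs (λ kv → sign (proj₁ b) * ((proj₁ kv * v (proj₂ kv) b) * y b))
        ≈⟨ sumK-cong cs (λ kv → rearrange _ (proj₁ kv) _ _) ⟩
      sumK cs (λ kv → proj₁ kv * (sign (proj₁ b) * (v (proj₂ kv) b * y b))) ∎

  kap : Gen → Clique3
  kap (genA p1 p3 q2 q3 δ _) = q2 , q3 , p3 , δ , 𝟙 , p1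
  kap (genB p1 p3 q2 q3)     = q2 , q3 , p3 , 𝟙 , 𝟙 , p1
  kap (genC p1 p2 q2 q3 δ _) = p2 , q2 , q3 , 𝟙 , δ , p1

  repr : Gen → Basis3
  repr (genA p1 p3 q2 q3 δ _) = ∘₁ , (p1 , 𝟙 , p3) , (δ , q2 , q3)
  repr (genB p1 p3 q2 q3)     = ∘₁ , (p1 , 𝟙 , p3) , (𝟙 , q2 , q3)
  repr (genC p1 p2 q2 q3 δ _) = ∘₂ , (p1 , p2 , 𝟙) , (δ , q2 , q3)

  repr-eval : ∀ g → eval (repr g) ≡ kap g
  repr-eval (genA p1 p3 q2 q3 δ _) = P.cong (λ d → q2 , q3 , p3 , d , 𝟙 , p1) (identityˡ δ)
  repr-eval (genB p1 p3 q2 q3)     = P.cong (λ d → q2 , q3 , p3 , d , 𝟙 , p1) (identityˡ 𝟙)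
  repr-eval (genC p1 p2 q2 q3 δ _) = P.cong (λ d → p2 , q2 , q3 , 𝟙 , d , p1) (identityˡ δ)

  ∘₁-support : ∀ A B C D E → ind (A ∧ B ∧ C ∧ D ∧ E) ≈ ind (C ∧ D ∧ B ∧ E ∧ (𝟙 == 𝟙) ∧ A)
  ∘₁-support A B C D E rewrite ==-refl 𝟙 = reflexive (P.cong ind (∘₁-reorder A B C D E))

  ∘₂-support : ∀ A B C D E → ind (A ∧ B ∧ C ∧ D ∧ E) ≈ ind (B ∧ C ∧ D ∧ (𝟙 == 𝟙) ∧ E ∧ A)
  ∘₂-support A B C D E rewrite ==-refl 𝟙 = reflexive (P.cong ind (∘₂-reorder A B C D E))

  vanishing-indicator : ∀ {s κ κ' k} → κ ≢ κ' → s * 0# ≈ k * ind (κ ==c κ')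
  vanishing-indicator κ≢κ' =
    trans (zeroʳ _) (sym (trans (*-cong refl (indicator-off κ≢κ')) (zeroʳ _)))

  gen-indicator : ∀ g → SignedIndicator (sign (proj₁ (repr g))) (kap g) (gen g)
  gen-indicator (genA p1 p3 q2 q3 δ _) (∘₁ , (a1 , a2 , a3) , (b1 , b2 , b3)) =
    *-cong refl (∘₁-support (a1 == p1) (a3 == p3) (b2 == q2) (b3 == q3) ((a2 ⋆ b1) == δ))
  gen-indicator (genA p1 p3 q2 q3 δ δ≢𝟙) (∘₂ , _) =
    vanishing-indicator (λ e → δ≢𝟙 (P.sym (P.cong (λ κ → proj₁ (proj₂ (proj₂ (proj₂ κ)))) e)))
  gen-indicator (genB p1 p3 q2 q3) (∘₁ , (a1 , a2 , a3) , (b1 , b2 , b3)) =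
    *-cong refl (∘₁-support (a1 == p1) (a3 == p3) (b2 == q2) (b3 == q3) ((a2 ⋆ b1) == 𝟙))
  gen-indicator (genB p1 p3 q2 q3) (∘₂ , (a1 , a2 , a3) , (b1 , b2 , b3)) = begin
    - 1# * - ind C ≈⟨ trans (-1*x≈-x _) (⁻¹-involutive _) ⟩
    ind C          ≈⟨ ∘₂-support (a1 == p1) (a2 == q2) (b2 == q3) (b3 == p3) ((a3 ⋆ b1) == 𝟙) ⟩
    ind _          ≈⟨ *-identityˡ _ ⟨
    1# * ind _     ∎
    where C = (a1 == p1) ∧ (a2 == q2) ∧ (b2 == q3) ∧ (b3 == p3) ∧ ((a3 ⋆ b1) == 𝟙)
  gen-indicator (genC p1 p2 q2 q3 δ δ≢𝟙) (∘₁ , _) =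
    vanishing-indicator (λ e → δ≢𝟙 (P.sym (P.cong (λ κ → proj₁ (proj₂ (proj₂ (proj₂ (proj₂ κ))))) e)))
  gen-indicator (genC p1 p2 q2 q3 δ _) (∘₂ , (a1 , a2 , a3) , (b1 , b2 , b3)) =
    *-cong refl (∘₂-support (a1 == p1) (a2 == p2) (b2 == q2) (b3 == q3) ((a3 ⋆ b1) == δ))

  generator-orthogonal : ∀ g y → InR y → pairing (gen g) y ≈ 0#
  generator-orthogonal g y y∈R =
    trans (pairing-signed-indicator (gen-indicator g) y) (trans (*-cong refl (y∈R (kap g))) (zeroʳ _))

  span-orthogonal : ∀ x → InSpanGen x → InR⊥ x
  span-orthogonal x (cs , hx) y y∈R =
    trans (pairing-linear cs gen x hx y)
          (sumK-zero cs (λ {kg} _ → trans (*-cong refl (generator-orthogonal (proj₂ kg) y y∈R)) (zeroʳ _)))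

  classify : Clique3 → Gen
  classify (k1 , k2 , k3 , k4 , k5 , k6) with k5 ≟ 𝟙 | k4 ≟ 𝟙
  ... | yes _    | yes _    = genB k6 k3 k1 k2
  ... | yes _    | no k4≢𝟙  = genA k6 k3 k1 k2 k4 k4≢𝟙
  ... | no k5≢𝟙  | _        = genC k6 k1 k2 k3 k5 k5≢𝟙

  classify-eval : ∀ b → kap (classify (eval b)) ≡ eval b
  classify-eval (∘₁ , (a1 , a2 , a3) , (b1 , b2 , b3)) with 𝟙 ≟ 𝟙 | (a2 ⋆ b1) ≟ 𝟙
  ... | yes _    | yes e = P.cong (λ d → b2 , b3 , a3 , d , 𝟙 , a1) (P.sym e)
  ... | yes _    | no _  = P.refl
  ... | no 𝟙≢𝟙   | _     = ⊥-elim (𝟙≢𝟙 P.refl)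
  classify-eval (∘₂ , (a1 , a2 , a3) , (b1 , b2 , b3)) with (a3 ⋆ b1) ≟ 𝟙 | 𝟙 ≟ 𝟙
  ... | yes e    | yes _ = P.cong (λ d → a2 , b2 , b3 , 𝟙 , d , a1) (P.sym e)
  ... | yes _    | no 𝟙≢𝟙 = ⊥-elim (𝟙≢𝟙 P.refl)
  ... | no _     | _     = P.refl

  representative : Basis3 → Basis3
  representative b = repr (classify (eval b))

  representative-eval : ∀ b → eval (representative b) ≡ eval b
  representative-eval b = P.trans (repr-eval (classify (eval b))) (classify-eval b)

  gen-off-fibre : ∀ g b → eval b ≢ kap g → gen g b ≈ 0#
  gen-off-fibre g b off = trans (sign-transpose (proj₁ b)
    (trans (gen-indicator g b) (trans (*-cong refl (indicator-off off)) (zeroʳ _)))) (zeroʳ _)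

  gen-on-fibre : ∀ g b → eval b ≡ kap g → gen g b ≈ sign (proj₁ b) * sign (proj₁ (repr g))
  gen-on-fibre g b on = sign-transpose (proj₁ b)
    (trans (gen-indicator g b) (trans (*-cong refl (indicator-on on)) (*-identityʳ _)))

  module Coordinates (x : Free3) where
    -- a basis element contributes its coefficient iff it is canonical
    entry : Basis3 → List (𝕂 × Gen)
    entry z with representative z ≟B z
    ... | yes _ = (x z , classify (eval z)) ∷ []
    ... | no _  = []

    coords : List (𝕂 × Gen)
    coords = concatMap entry basis3

    term : Basis3 → 𝕂 × Gen → 𝕂
    term b kg = proj₁ kg * gen (proj₂ kg) b

    entry-off : ∀ b z → z ≢ representative b → sumK (entry z) (term b) ≈ 0#
    entry-off b z z≢rep with representative z ≟B z
    ... | no _ = refl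
    ... | yes canonical =
      trans (+-identityʳ _) (trans (*-cong refl (gen-off-fibre _ b same-fibre)) (zeroʳ _))
      where
      same-fibre : eval b ≢ kap (classify (eval z))
      same-fibre e = z≢rep (P.trans (P.sym canonical)
        (P.cong (λ κ → repr (classify κ)) (P.trans (P.sym (classify-eval z)) (P.sym e))))

    entry-at : FibreConstant x → ∀ b → sumK (entry (representative b)) (term b) ≈ x b
    entry-at fc b with representative (representative b) ≟B representative b
    ... | no not-canonical =
      ⊥-elim (not-canonical (P.cong (λ κ → repr (classify κ)) (representative-eval b)))
    ... | yes _ = begin
      x r * gen (classify (eval r)) b + 0#    ≈⟨ +-identityʳ _ ⟩
      x r * gen (classify (eval r)) b
        ≈⟨ *-cong refl (reflexive (P.cong (λ κ → gen (classify κ) b) (representative-eval b))) ⟩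
      x r * gen (classify (eval b)) b
        ≈⟨ *-cong refl (gen-on-fibre _ b (P.sym (classify-eval b))) ⟩
      x r * (sign (proj₁ b) * sign (proj₁ r)) ≈⟨ *-comm _ _ ⟩
      (sign (proj₁ b) * sign (proj₁ r)) * x r ≈⟨ *-assoc _ _ _ ⟩
      sign (proj₁ b) * (sign (proj₁ r) * x r) ≈⟨ *-cong refl (fc r b (representative-eval b)) ⟩
      sign (proj₁ b) * (sign (proj₁ b) * x b) ≈⟨ sign-involutive (proj₁ b) (x b) ⟩
      x b ∎
      where r = representative b

    coords-spec : FibreConstant x → ∀ b → x b ≈ sumK coords (term b)
    coords-spec fc b = sym (begin
      sumK coords (term b)                             ≈⟨ sumK-concatMap entry basis3 (term b) ⟩
      sumK basis3 (λ z → sumK (entry z) (term b))      ≈⟨ delta-basis3 _ _ (entry-off b) ⟩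
      sumK (entry (representative b)) (term b)         ≈⟨ entry-at fc b ⟩
      x b ∎)

  fibre-constant-in-span : ∀ x → FibreConstant x → InSpanGen x
  fibre-constant-in-span x fc = coords , coords-spec fc
    where open Coordinates x

proposition3p4 : ∀ {c ℓ m} (K : Field c ℓ) → CharacteristicZero K →
    (M : FiniteUnitaryMagma m) →
    let open Koszul K M in
    ∀ (x : Free3) → InR⊥ x ⇔ InSpanGen x
proposition3p4 K _ M x =
  mk⇔ (λ x⊥R → fibre-constant-in-span x (orthogonal-fibre-constant x x⊥R))
      (span-orthogonal x)
  where open KoszulDualOfNCM K M
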